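{- Let $\mathcal{G}=(V,E_L,E_R)$ and $\mathcal{G}'=(V',E'_L,E'_R)$ be achievement positional games with $V\cap V'=\varnothing$. Suppose Left has a winning strategy on $\mathcal{G}$ as first player and Right has a winning strategy on $\mathcal{G}'$ as first player. Let $d$ be the Left-delay of $\mathcal{G}$ and $d'$ the Right-delay of $\mathcal{G}'$. If $d \leq d'$, then Left has a winning strategy on $\mathcal{G}\cup\mathcal{G}'$ as first player. If $d' \leq d$, then Right has a winning strategy on $\mathcal{G}\cup\mathcal{G}'$ as first player. In particular, at least one of Left and Right has a winning strategy as first player on $\mathcal{G}\cup\mathcal{G}'$.
   Context: An achievement positional game is a triple $\mathcal{G}=(V,E_L,E_R)$ where $V$ is a finite set and $E_L, E_R \subseteq 2^V\setminus\{\varnothing\}$ (blue and red edges). Left and Right alternately pick a previously unpicked vertex; whoever first fills (picks all vertices of) an edge of their own color (blue for Left, red for Right) wins; if no one does before all vertices are picked, the game is a draw. For games with disjoint vertex sets, the disjoint union is $\mathcal{G}\cup\mathcal{G}'=(V\cup V', E_L\cup E'_L, E_R\cup E'_R)$. If Left has a winning strategy on $\mathcal{G}$ as first player, the Left-delay of $\mathcal{G}$ is defined via the following scoring game: the game $\mathcal{G}$ is played with Left moving first and moving normally, while Right, on each of her turns, may either pick a vertex normally or pass. The game ends when Left fills a blue edge, Right fills a red edge, or all vertices are picked. The score is $+\infty$ if Left has not filled a blue edge, and otherwise the total number of passes made by Right. Left aims to minimize and Right to maximize the score; the Left-delay is the score under optimal play (it is finite). The Right-delay of a game on which Right has a winning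 strategy as first player is defined symmetrically (Right moves first and normally, Left may pass, score counts Left's passes if Right fills a red edge, $+\infty$ otherwise; Right minimizes, Left maximizes). -}

module Defs where

open import Data.Nat using (ℕ; zero; suc; _+_; _≤_)
open import Data.Fin using (Fin)
open import Data.Fin.Subset using (Subset; _∈_; Nonempty) renaming (⊥ to ∅)
open import Data.Vec using (Vec; replicate; lookup; _[_]≔_) renaming (_++_ to _++ᵛ_)
open import Data.List using (List; map) renaming (_++_ to _++ˡ_)
open import Data.List.Membership.Propositional renaming (_∈_ to _∈ₗ_)
open import Data.Maybe using (Maybe; just; nothing)
open import Data.Product using (Σ; ∃; _×_; _,_)
open import Data.Sum using (_⊎_)
open import Relation.Binary.PropositionalEquality using (_≡_)
open import Relation.Nullary using (¬_)

data Player : Set where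
  L R : Player

opp : Player → Player
opp L = R
opp R = L

record Game : Set where
  field
    n  : ℕ
    EL : List (Subset n)
    ER : List (Subset n)
open Game public

edges : (G : Game) → Player → List (Subset (n G))
edges G L = EL G
edges G R = ER G

WellFormed : Game → Set
WellFormed G = (∀ e → e ∈ₗ EL G → Nonempty e) × (∀ e → e ∈ₗ ER G → Nonempty e)

-- Disjoint union: vertices of G are Fin n ⊆ Fin (n + m) (first block),
-- vertices of G' are the second block.
_⊕_ : Game → Game → Game
G ⊕ G' = record
  { n  = n G + n G'
  ; EL = map (λ e → e ++ᵛ ∅ {n G'}) (EL G) ++ˡ map (λ e → ∅ {n G} ++ᵛ e) (EL G')
  ; ER = map (λ e → e ++ᵛ ∅ {n G'}) (ER G) ++ˡ map (λ e → ∅ {n G} ++ᵛ e) (ER G')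
  }

-- A board records, for each vertex, who picked it (nothing = unpicked).
Board : ℕ → Set
Board k = Vec (Maybe Player) k

emptyBoard : (G : Game) → Board (n G)
emptyBoard G = replicate (n G) nothing

Free : {k : ℕ} → Board k → Fin k → Set
Free b i = lookup b i ≡ nothing

pick : {k : ℕ} → Board k → Fin k → Player → Board k
pick b i p = b [ i ]≔ just p

Filled : (G : Game) → Player → Board (n G) → Set
Filled G p b = Σ (Subset (n G)) λ e → e ∈ₗ edges G p × (∀ i → i ∈ e → lookup b i ≡ just p)

-- Positions reached are always positions where nobody has won yet.
-- WinMove G p b : it is p's turn at b, and p can force a win.
-- WinResp G p b : it is (opp p)'s turn at b, and p can force a win.
-- (If all vertices are picked and nobody has won, the game is a draw: no constructor applies.)
mutual
  data WinMove (G : Game) (p : Player) (b : Board (n G)) : Set where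
    move : (i : Fin (n G)) → Free b i →
           Filled G p (pick b i p) ⊎ WinResp G p (pick b i p) →
           WinMove G p b

  data WinResp (G : Game) (p : Player) (b : Board (n G)) : Set where
    resp : (∃ λ i → Free b i) →
           (∀ i → Free b i →
              ¬ Filled G (opp p) (pick b i (opp p)) × WinMove G p (pick b i (opp p))) →
           WinResp G p b

WinsFirst : Game → Player → Set
WinsFirst G p = WinMove G p (emptyBoard G)

-- Delay scoring game: p moves first and normally; the opponent may, on each
-- of its turns, pick a vertex or pass.  The score is +∞ unless p fills one of
-- its edges, in which case it is the number of passes of the opponent.
-- DelayMove G p k b : p to move at b, and p can guarantee a score ≤ k.
-- DelayResp G p k b : opponent to move at b, and p can guarantee a score ≤ k.
-- (A pass costs one unit of the budget, so DelayResp with budget 0 is impossible.)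
mutual
  data DelayMove (G : Game) (p : Player) (k : ℕ) (b : Board (n G)) : Set where
    dmove : (i : Fin (n G)) → Free b i →
            Filled G p (pick b i p) ⊎ DelayResp G p k (pick b i p) →
            DelayMove G p k b

  data DelayResp (G : Game) (p : Player) : ℕ → Board (n G) → Set where
    dresp : ∀ {k b} →
            (∃ λ i → Free b i) →
            (∀ i → Free b i →
               ¬ Filled G (opp p) (pick b i (opp p)) × DelayMove G p (suc k) (pick b i (opp p))) →
            DelayMove G p k b →          -- the opponent passes
            DelayResp G p (suc k) b

DelayAtMost : Game → Player → ℕ → Set
DelayAtMost G p k = DelayMove G p k (emptyBoard G)

IsDelay : Game → Player → ℕ → Set
IsDelay G p d = DelayAtMost G p d × (∀ k → DelayAtMost G p k → d ≤ k)

-- Left follows an optimal strategy for the Left-delay game on G while keeping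
-- Right's delay in G' at least Left's remaining budget of passes in G.  Right's
-- moves in G are answered in G.  A Right move in G' is answered in G' if some
-- reply keeps Right's delay there at least the budget; otherwise Left treats it
-- as a Right pass in G, which lowers both sides by one.  Since d ≤ d' initially,
-- Right never completes G' in time, and Left completes G.  Exchanging colours
-- gives the case d' ≤ d.
module Submission where

open import Defs
open import Data.Nat using (ℕ; zero; suc; _+_; _≤_; _<_; s≤s)
open import Data.Nat.Properties using (≤-refl; ≤-total; <⇒≱; <-trans; <-≤-trans; ≤-<-trans; ≤-pred)
open import Data.Fin using (Fin; zero; suc; _↑ˡ_; _↑ʳ_; splitAt)
open import Data.Fin.Properties using (any?; all?; ¬∀⟶∃¬; splitAt⁻¹-↑ˡ; splitAt⁻¹-↑ʳ)
  renaming (_≟_ to _≟ᶠ_)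
open import Data.Fin.Subset using (Subset; Nonempty; _∈_) renaming (⊥ to ∅)
open import Data.Fin.Subset.Properties using (_∈?_; ∉⊥)
open import Data.Vec using ([]; _∷_; replicate; lookup) renaming (_++_ to _++ᵛ_)
open import Data.Vec.Properties
  using ([]=⇒lookup; lookup⇒[]=; lookup-++ˡ; lookup-++ʳ; []≔-++-↑ˡ; []≔-++-↑ʳ;
         lookup∘update; lookup∘update′; lookup-replicate)
open import Data.List using (map) renaming (_++_ to _++ˡ_)
open import Data.List.Relation.Unary.Any using () renaming (any? to anyˡ?)
open import Data.List.Membership.Propositional using (find; lose) renaming (_∈_ to _∈ₗ_)
open import Data.List.Membership.Propositional.Properties using (∈-map⁺; ∈-map⁻; ∈-++⁺ˡ; ∈-++⁺ʳ; ∈-++⁻)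
open import Data.Maybe using (just; nothing)
open import Data.Maybe.Properties using (just-injective) renaming (≡-dec to ≡-decᴹ)
open import Data.Product using (∃; _×_; _,_; proj₁; proj₂)
open import Data.Sum using (_⊎_; inj₁; inj₂; [_,_]′)
open import Data.Unit using (⊤; tt)
open import Function using (_∘_)
open import Relation.Binary.PropositionalEquality using (_≡_; refl; sym; trans; cong; subst; _≢_)
open import Relation.Nullary using (¬_; Dec; yes; no; contradiction)
open import Relation.Nullary.Decidable using (map′; _×-dec_; _⊎-dec_; _→-dec_; ¬?)

opp-involutive : ∀ p → opp (opp p) ≡ p
opp-involutive L = refl
opp-involutive R = refl

opp-≢ : ∀ p → p ≢ opp p
opp-≢ L ()
opp-≢ R ()

_≟ᴾ_ : (p r : Player) → Dec (p ≡ r)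
L ≟ᴾ L = yes refl
L ≟ᴾ R = no λ ()
R ≟ᴾ L = no λ ()
R ≟ᴾ R = yes refl

freeCount : ∀ {k} → Board k → ℕ
freeCount []             = 0
freeCount (nothing ∷ b)  = suc (freeCount b)
freeCount (just _ ∷ b)   = freeCount b

freeCount-pick : ∀ {k} (b : Board k) i p → Free b i → freeCount (pick b i p) < freeCount b
freeCount-pick (nothing ∷ b) zero    p _  = ≤-refl
freeCount-pick (nothing ∷ b) (suc i) p fr = s≤s (freeCount-pick b i p fr)
freeCount-pick (just _ ∷ b)  (suc i) p fr = freeCount-pick b i p fr

fuel-pick : ∀ {k m} (b : Board k) i p → Free b i → freeCount b < suc m → freeCount (pick b i p) < m
fuel-pick b i p fr b<m = <-≤-trans (freeCount-pick b i p fr) (≤-pred b<m)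

Free? : ∀ {k} (b : Board k) i → Dec (Free b i)
Free? b i = ≡-decᴹ _≟ᴾ_ (lookup b i) nothing

Covers : ∀ {k} → Player → Board k → Subset k → Set
Covers r b e = ∀ i → i ∈ e → lookup b i ≡ just r

Filled? : ∀ G r (b : Board (n G)) → Dec (Filled G r b)
Filled? G r b = map′ find (λ (e , e∈ , c) → lose e∈ c) (anyˡ? Covers? (edges G r))
  where
  Covers? : ∀ e → Dec (Covers r b e)
  Covers? e = all? λ i → i ∈? e →-dec ≡-decᴹ _≟ᴾ_ (lookup b i) (just r)

lookup-pick-other : ∀ {k r s} (b : Board k) i j → s ≢ r →
                    lookup (pick b i s) j ≡ just r → lookup b j ≡ just r
lookup-pick-other b i j s≢r eq with j ≟ᶠ i
... | yes refl = contradiction (just-injective (trans (sym (lookup∘update i b _)) eq)) s≢r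
... | no j≢i   = trans (sym (lookup∘update′ j≢i b _)) eq

filled-pick-other : ∀ G {r s} (b : Board (n G)) i → s ≢ r → Filled G r (pick b i s) → Filled G r b
filled-pick-other G b i s≢r (e , e∈ , c) = e , e∈ , λ j j∈ → lookup-pick-other b i j s≢r (c j j∈)

edges-nonempty : ∀ {G} → WellFormed G → ∀ r e → e ∈ₗ edges G r → Nonempty e
edges-nonempty (nonemptyᴸ , _) L = nonemptyᴸ
edges-nonempty (_ , nonemptyᴿ) R = nonemptyᴿ

¬Filled-empty : ∀ {G} r → WellFormed G → ¬ Filled G r (emptyBoard G)
¬Filled-empty r wf (e , e∈ , c) =
  let (i , i∈) = edges-nonempty wf r e e∈
  in contradiction (trans (sym (lookup-replicate i nothing)) (c i i∈)) λ ()

module _ (G : Game) (q : Player) where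

  Withstands : ℕ → Board (n G) → Fin (n G) → Set
  Withstands k b i = Free b i → ¬ Filled G (opp q) (pick b i (opp q)) × DelayMove G q k (pick b i (opp q))

  Withstands? : ∀ {k b} → (∀ i → Free b i → Dec (DelayMove G q k (pick b i (opp q)))) →
                ∀ i → Dec (Withstands k b i)
  Withstands? {b = b} decide i with Free? b i
  ... | no ¬fr = yes λ fr → contradiction fr ¬fr
  ... | yes fr = map′ (λ w _ → w) (λ w → w fr) (¬? (Filled? G (opp q) (pick b i (opp q))) ×-dec decide i fr)

  ¬Withstands : ∀ {k b} i → ¬ Withstands k b i →
                Free b i × (Filled G (opp q) (pick b i (opp q)) ⊎ ¬ DelayMove G q k (pick b i (opp q)))
  ¬Withstands {b = b} i ¬w with Free? b i | Filled? G (opp q) (pick b i (opp q))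
  ... | no ¬fr | _      = contradiction (λ fr → contradiction fr ¬fr) ¬w
  ... | yes fr | yes fl = fr , inj₁ fl
  ... | yes fr | no ¬fl = fr , inj₂ λ σ → ¬w λ _ → ¬fl , σ

  -- Decided by recursion on the number of free vertices, which every pick decreases.
  mutual
    DelayMove-fuel? : ∀ m k b → freeCount b < m → Dec (DelayMove G q k b)
    DelayMove-fuel? (suc m) k b b<m =
      map′ (λ (i , fr , w) → dmove i fr w) (λ { (dmove i fr w) → i , fr , w }) (any? good?)
      where
      good? : ∀ i → Dec (Free b i × (Filled G q (pick b i q) ⊎ DelayResp G q k (pick b i q)))
      good? i with Free? b i
      ... | no ¬fr = no (¬fr ∘ proj₁)
      ... | yes fr =
        map′ (fr ,_) proj₂ (Filled? G q (pick b i q) ⊎-dec DelayResp-fuel? m k _ (fuel-pick b i q fr b<m))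

    DelayResp-fuel? : ∀ m k b → freeCount b < m → Dec (DelayResp G q k b)
    DelayResp-fuel? m       zero    b _   = no λ ()
    DelayResp-fuel? (suc m) (suc k) b b<m =
      map′ (λ (ex , ws , pass) → dresp ex ws pass) (λ { (dresp ex ws pass) → ex , ws , pass })
           (any? (Free? b)
             ×-dec all? (Withstands? λ i fr → DelayMove-fuel? m (suc k) _ (fuel-pick b i (opp q) fr b<m))
             ×-dec DelayMove-fuel? (suc m) k b b<m)

  DelayMove? : ∀ k b → Dec (DelayMove G q k b)
  DelayMove? k b = DelayMove-fuel? (suc (freeCount b)) k b ≤-refl

  ¬DelayResp⇒counter : ∀ {p} j b → opp q ≡ p → ¬ DelayResp G q (suc j) b →
    (∃ λ i → Free b i × (Filled G p (pick b i p) ⊎ ¬ DelayMove G q (suc j) (pick b i p)))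
    ⊎ ¬ DelayMove G q j b
  ¬DelayResp⇒counter j b refl ¬ρ with DelayMove? j b
  ... | no ¬pass = inj₂ ¬pass
  ... | yes pass@(dmove i fr _) =
    let (i′ , ¬w) = ¬∀⟶∃¬ (n G) _ (Withstands? λ i _ → DelayMove? (suc j) _)
                                   (λ ws → ¬ρ (dresp (i , fr) ws pass))
    in inj₁ (i′ , ¬Withstands i′ ¬w)

record DisjointUnion (U H H' : Game) : Set where
  field
    join         : Board (n H) → Board (n H') → Board (n U)
    injˡ         : Fin (n H) → Fin (n U)
    injʳ         : Fin (n H') → Fin (n U)
    injˡ-or-injʳ : ∀ i → (∃ λ j → i ≡ injˡ j) ⊎ (∃ λ j → i ≡ injʳ j)
    lookup-injˡ  : ∀ b b' j → lookup (join b b') (injˡ j) ≡ lookup b j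
    lookup-injʳ  : ∀ b b' j → lookup (join b b') (injʳ j) ≡ lookup b' j
    pick-injˡ    : ∀ b b' j r → pick (join b b') (injˡ j) r ≡ join (pick b j r) b'
    pick-injʳ    : ∀ b b' j r → pick (join b b') (injʳ j) r ≡ join b (pick b' j r)
    filled-joinˡ : ∀ r b b' → Filled H r b → Filled U r (join b b')
    filled-joinʳ : ∀ r b b' → Filled H' r b' → Filled U r (join b b')
    filled-join⁻ : ∀ r b b' → Filled U r (join b b') → Filled H r b ⊎ Filled H' r b'
    join-empty   : join (emptyBoard H) (emptyBoard H') ≡ emptyBoard U

  ¬filled-join : ∀ {r b b'} → ¬ Filled H r b → ¬ Filled H' r b' → ¬ Filled U r (join b b')
  ¬filled-join ¬fl ¬fl' = [ ¬fl , ¬fl' ]′ ∘ filled-join⁻ _ _ _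

  moveˡ : ∀ {p b b'} j → Free b j →
          Filled U p (join (pick b j p) b') ⊎ WinResp U p (join (pick b j p) b') → WinMove U p (join b b')
  moveˡ {p} {b} {b'} j fr w =
    move (injˡ j) (trans (lookup-injˡ b b' j) fr)
         (subst (λ c → Filled U p c ⊎ WinResp U p c) (sym (pick-injˡ b b' j p)) w)

  moveʳ : ∀ {p b b'} j → Free b' j →
          Filled U p (join b (pick b' j p)) ⊎ WinResp U p (join b (pick b' j p)) → WinMove U p (join b b')
  moveʳ {p} {b} {b'} j fr w =
    move (injʳ j) (trans (lookup-injʳ b b' j) fr)
         (subst (λ c → Filled U p c ⊎ WinResp U p c) (sym (pick-injʳ b b' j p)) w)

  pick-cases : ∀ {b b'} r (P : Board (n U) → Set) →
               (∀ j → Free b j → P (join (pick b j r) b')) →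
               (∀ j → Free b' j → P (join b (pick b' j r))) →
               ∀ i → Free (join b b') i → P (pick (join b b') i r)
  pick-cases {b} {b'} r P inH inH' i fr with injˡ-or-injʳ i
  ... | inj₁ (j , refl) = subst P (sym (pick-injˡ b b' j r)) (inH j (trans (sym (lookup-injˡ b b' j)) fr))
  ... | inj₂ (j , refl) = subst P (sym (pick-injʳ b b' j r)) (inH' j (trans (sym (lookup-injʳ b b' j)) fr))

swap : ∀ {U H H'} → DisjointUnion U H H' → DisjointUnion U H' H
swap D = record
  { join         = λ b' b → join b b'
  ; injˡ         = injʳ
  ; injʳ         = injˡ
  ; injˡ-or-injʳ = λ i → [ inj₂ , inj₁ ]′ (injˡ-or-injʳ i)
  ; lookup-injˡ  = λ b' b → lookup-injʳ b b'
  ; lookup-injʳ  = λ b' b → lookup-injˡ b b'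
  ; pick-injˡ    = λ b' b → pick-injʳ b b'
  ; pick-injʳ    = λ b' b → pick-injˡ b b'
  ; filled-joinˡ = λ r b' b → filled-joinʳ r b b'
  ; filled-joinʳ = λ r b' b → filled-joinˡ r b b'
  ; filled-join⁻ = λ r b' b → [ inj₂ , inj₁ ]′ ∘ filled-join⁻ r b b'
  ; join-empty   = join-empty
  }
  where open DisjointUnion D

splitAt-view : ∀ a {k} (i : Fin (a + k)) → (∃ λ j → i ≡ j ↑ˡ k) ⊎ (∃ λ j → i ≡ a ↑ʳ j)
splitAt-view a i with splitAt a i in eq
... | inj₁ j = inj₁ (j , sym (splitAt⁻¹-↑ˡ eq))
... | inj₂ j = inj₂ (j , sym (splitAt⁻¹-↑ʳ eq))

∈-resp-lookup : ∀ {a k} {e : Subset a} {f : Subset k} {i j} → lookup e i ≡ lookup f j → i ∈ e → j ∈ f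
∈-resp-lookup {f = f} {j = j} eq i∈ = lookup⇒[]= j f (trans (sym eq) ([]=⇒lookup i∈))

replicate-++ : ∀ {A : Set} a k (x : A) → replicate a x ++ᵛ replicate k x ≡ replicate (a + k) x
replicate-++ zero    k x = refl
replicate-++ (suc a) k x = cong (x ∷_) (replicate-++ a k x)

module _ {a k} {r : Player} (b : Board a) (b' : Board k) where

  covers-++ˡ : ∀ {e} → Covers r b e → Covers r (b ++ᵛ b') (e ++ᵛ ∅)
  covers-++ˡ {e} c i i∈ with splitAt-view a i
  ... | inj₁ (j , refl) = trans (lookup-++ˡ b b' j) (c j (∈-resp-lookup (lookup-++ˡ e (∅ {k}) j) i∈))
  ... | inj₂ (j , refl) = contradiction (∈-resp-lookup {f = ∅ {k}} (lookup-++ʳ e (∅ {k}) j) i∈) ∉⊥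

  covers-++ʳ : ∀ {e} → Covers r b' e → Covers r (b ++ᵛ b') (∅ ++ᵛ e)
  covers-++ʳ {e} c i i∈ with splitAt-view a i
  ... | inj₁ (j , refl) = contradiction (∈-resp-lookup {f = ∅ {a}} (lookup-++ˡ (∅ {a}) e j) i∈) ∉⊥
  ... | inj₂ (j , refl) = trans (lookup-++ʳ b b' j) (c j (∈-resp-lookup (lookup-++ʳ (∅ {a}) e j) i∈))

  covers-++ˡ⁻ : ∀ {e} → Covers r (b ++ᵛ b') (e ++ᵛ ∅) → Covers r b e
  covers-++ˡ⁻ {e} c j j∈ =
    trans (sym (lookup-++ˡ b b' j)) (c (j ↑ˡ k) (∈-resp-lookup (sym (lookup-++ˡ e (∅ {k}) j)) j∈))

  covers-++ʳ⁻ : ∀ {e} → Covers r (b ++ᵛ b') (∅ ++ᵛ e) → Covers r b' e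
  covers-++ʳ⁻ {e} c j j∈ =
    trans (sym (lookup-++ʳ b b' j)) (c (a ↑ʳ j) (∈-resp-lookup (sym (lookup-++ʳ (∅ {a}) e j)) j∈))

module _ (G G' : Game) where

  edges-⊕ : ∀ r → edges (G ⊕ G') r ≡ map (_++ᵛ ∅) (edges G r) ++ˡ map (∅ ++ᵛ_) (edges G' r)
  edges-⊕ L = refl
  edges-⊕ R = refl

  filled-⊕ˡ : ∀ r b b' → Filled G r b → Filled (G ⊕ G') r (b ++ᵛ b')
  filled-⊕ˡ r b b' (e , e∈ , c) =
    e ++ᵛ ∅ , subst (e ++ᵛ ∅ ∈ₗ_) (sym (edges-⊕ r)) (∈-++⁺ˡ (∈-map⁺ _ e∈)) , covers-++ˡ b b' c

  filled-⊕ʳ : ∀ r b b' → Filled G' r b' → Filled (G ⊕ G') r (b ++ᵛ b')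
  filled-⊕ʳ r b b' (e , e∈ , c) =
    ∅ ++ᵛ e , subst (∅ ++ᵛ e ∈ₗ_) (sym (edges-⊕ r)) (∈-++⁺ʳ _ (∈-map⁺ _ e∈)) , covers-++ʳ b b' c

  filled-⊕⁻ : ∀ r b b' → Filled (G ⊕ G') r (b ++ᵛ b') → Filled G r b ⊎ Filled G' r b'
  filled-⊕⁻ r b b' (e , e∈ , c) with ∈-++⁻ (map (_++ᵛ ∅) (edges G r)) (subst (e ∈ₗ_) (edges-⊕ r) e∈)
  ... | inj₁ e∈ˡ with ∈-map⁻ _ e∈ˡ
  ...   | e₀ , e₀∈ , refl = inj₁ (e₀ , e₀∈ , covers-++ˡ⁻ b b' c)
  filled-⊕⁻ r b b' (e , e∈ , c) | inj₂ e∈ʳ with ∈-map⁻ _ e∈ʳ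
  ...   | e₀ , e₀∈ , refl = inj₂ (e₀ , e₀∈ , covers-++ʳ⁻ b b' c)

  ⊕-disjointUnion : DisjointUnion (G ⊕ G') G G'
  ⊕-disjointUnion = record
    { join         = _++ᵛ_
    ; injˡ         = _↑ˡ n G'
    ; injʳ         = n G ↑ʳ_
    ; injˡ-or-injʳ = splitAt-view (n G)
    ; lookup-injˡ  = lookup-++ˡ
    ; lookup-injʳ  = lookup-++ʳ
    ; pick-injˡ    = λ b b' j r → []≔-++-↑ˡ b b' j
    ; pick-injʳ    = λ b b' j r → []≔-++-↑ʳ b b' j
    ; filled-joinˡ = filled-⊕ˡ
    ; filled-joinʳ = filled-⊕ʳ
    ; filled-join⁻ = filled-⊕⁻
    ; join-empty   = replicate-++ (n G) (n G') nothing
    }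

NoDelayBelow : (G : Game) → Player → ℕ → Board (n G) → Set
NoDelayBelow G p zero    b = ⊤
NoDelayBelow G p (suc k) b = ¬ DelayMove G p k b

IsDelay⇒NoDelayBelow : ∀ {G p d k} → IsDelay G p d → k ≤ d → NoDelayBelow G p k (emptyBoard G)
IsDelay⇒NoDelayBelow {k = zero}  _             _   = tt
IsDelay⇒NoDelayBelow {k = suc k} (_ , minimal) k<d σ = <⇒≱ k<d (minimal k σ)

module DelayRace {U H H'} (D : DisjointUnion U H H') (p : Player) where
  open DisjointUnion D

  q : Player
  q = opp p

  mutual
    win-move : ∀ m k b b' → freeCount b' < m → DelayMove H p k b → NoDelayBelow H' q k b' →
               ¬ Filled H q b → ¬ Filled H' q b' → WinMove U p (join b b')
    win-move m k b b' b'<m (dmove i fr (inj₁ fl)) _ _ _ = moveˡ i fr (inj₁ (filled-joinˡ p _ b' fl))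
    win-move m k b b' b'<m (dmove i fr (inj₂ ρ)) nd ¬fl ¬fl' =
      moveˡ i fr (inj₂ (win-resp m k _ b' b'<m ρ nd (¬fl ∘ filled-pick-other H b i (opp-≢ p)) ¬fl'))

    win-resp : ∀ m k b b' → freeCount b' < m → DelayResp H p k b → NoDelayBelow H' q k b' →
               ¬ Filled H q b → ¬ Filled H' q b' → WinResp U p (join b b')
    win-resp m (suc k) b b' b'<m ρ@(dresp (i , fr) withstands _) nd ¬fl ¬fl' =
      resp (injˡ i , trans (lookup-injˡ b b' i) fr) (pick-cases q (λ c → ¬ Filled U q c × WinMove U p c) inH inH')
      where
      inH : ∀ j → Free b j → ¬ Filled U q (join (pick b j q) b') × WinMove U p (join (pick b j q) b')
      inH j fr = ¬filled-join (proj₁ (withstands j fr)) ¬fl' ,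
                 win-move m (suc k) _ b' b'<m (proj₂ (withstands j fr)) nd (proj₁ (withstands j fr)) ¬fl'

      inH' : ∀ j → Free b' j → ¬ Filled U q (join b (pick b' j q)) × WinMove U p (join b (pick b' j q))
      inH' j fr' = ¬filled-join ¬fl ¬fl₁' ,
                   win-counter m k b _ (≤-<-trans (freeCount-pick b' j q fr') b'<m)
                               ρ (nd ∘ dmove j fr' ∘ inj₂) ¬fl ¬fl₁'
        where
        ¬fl₁' : ¬ Filled H' q (pick b' j q)
        ¬fl₁' = nd ∘ dmove j fr' ∘ inj₁

    -- The opponent has just moved in H'; p answers there, or treats that move as
    -- a pass in H.  The fuel bound carries an extra suc so that every call made
    -- from here decreases m, which is what the termination checker needs.
    win-counter : ∀ m k b b' → suc (freeCount b') < m → DelayResp H p (suc k) b → ¬ DelayResp H' q k b' →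
                  ¬ Filled H q b → ¬ Filled H' q b' → WinMove U p (join b b')
    win-counter (suc m) zero b b' b'<m (dresp _ _ pass) _ ¬fl ¬fl' =
      win-move m zero b b' (≤-pred b'<m) pass tt ¬fl ¬fl'
    win-counter (suc m) (suc k) b b' b'<m ρ@(dresp _ _ pass) ¬ρ' ¬fl ¬fl'
      with ¬DelayResp⇒counter H' q k b' (opp-involutive p) ¬ρ'
    ... | inj₂ ¬pass' = win-move m (suc k) b b' (≤-pred b'<m) pass ¬pass' ¬fl ¬fl'
    ... | inj₁ (i , fr' , inj₁ fl') = moveʳ i fr' (inj₁ (filled-joinʳ p b _ fl'))
    ... | inj₁ (i , fr' , inj₂ ¬σ') =
      moveʳ i fr' (inj₂ (win-resp m (suc (suc k)) b _ (<-trans (freeCount-pick b' i p fr') (≤-pred b'<m))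
                                  ρ ¬σ' ¬fl (¬fl' ∘ filled-pick-other H' b' i (opp-≢ p))))

  delay-race : ∀ {k} → WellFormed H → WellFormed H' → DelayAtMost H p k → NoDelayBelow H' q k (emptyBoard H') →
               WinsFirst U p
  delay-race wf wf' σ nd =
    subst (WinMove U p) join-empty (win-move _ _ _ _ ≤-refl σ nd (¬Filled-empty q wf) (¬Filled-empty q wf'))

open DelayRace using (delay-race)

proposition3p1 : (G G' : Game) → WellFormed G → WellFormed G' →
    WinsFirst G L → WinsFirst G' R →
    (d d' : ℕ) → IsDelay G L d → IsDelay G' R d' →
    (d ≤ d' → WinsFirst (G ⊕ G') L) ×
    (d' ≤ d → WinsFirst (G ⊕ G') R) ×
    (WinsFirst (G ⊕ G') L ⊎ WinsFirst (G ⊕ G') R)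
proposition3p1 G G' wf wf' _ _ d d' delay delay' =
  left-wins , right-wins , [ inj₁ ∘ left-wins , inj₂ ∘ right-wins ]′ (≤-total d d')
  where
  left-wins : d ≤ d' → WinsFirst (G ⊕ G') L
  left-wins d≤d' = delay-race (⊕-disjointUnion G G') L wf wf' (proj₁ delay) (IsDelay⇒NoDelayBelow delay' d≤d')

  right-wins : d' ≤ d → WinsFirst (G ⊕ G') R
  right-wins d'≤d = delay-race (swap (⊕-disjointUnion G G')) R wf' wf (proj₁ delay') (IsDelay⇒NoDelayBelow delay d'≤d)
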